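{- Let $G$ be a connected graph with $m$ edges and maximum degree $\Delta(G)$. Then $$C(G)\le \frac{m(\Delta(G)-1)}{2}.$$
   Context: All graphs are finite and simple. For a connected graph $G$, regard each edge as a unit resistor. $\Omega_G(i,j)$ is the effective resistance between $i$ and $j$. The global cyclicity index is $$C(G)=\sum_{ij\in E(G)}\Big[\frac{1}{\Omega_G(i,j)}-1\Big].$$ -}

module Defs where

open import Data.Bool using (Bool; true; false; if_then_else_)
open import Data.Nat as ℕ using (ℕ; zero; suc; _⊔_)
open import Data.Fin using (Fin; zero; suc; _<?_)
open import Data.Fin.Properties using (_≟_)
open import Data.Integer using (ℤ; +_)
open import Data.Rational using (ℚ; 0ℚ; 1ℚ; _+_; _*_; _-_; _/_)
open import Data.Product using (Σ; _×_)
open import Relation.Nullary.Decidable using (⌊_⌋)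
open import Relation.Binary.PropositionalEquality using (_≡_)

record Graph (n : ℕ) : Set where
  field
    adj    : Fin n → Fin n → Bool
    sym    : ∀ i j → adj i j ≡ adj j i
    irrefl : ∀ i → adj i i ≡ false
open Graph public

sumℚ : ∀ {n} → (Fin n → ℚ) → ℚ
sumℚ {zero}  f = 0ℚ
sumℚ {suc n} f = f zero + sumℚ (λ i → f (suc i))

sumℕ : ∀ {n} → (Fin n → ℕ) → ℕ
sumℕ {zero}  f = 0
sumℕ {suc n} f = f zero ℕ.+ sumℕ (λ i → f (suc i))

maxℕ : ∀ {n} → (Fin n → ℕ) → ℕ
maxℕ {zero}  f = 0
maxℕ {suc n} f = f zero ⊔ maxℕ (λ i → f (suc i))

data Reach {n} (G : Graph n) : Fin n → Fin n → Set where
  here : ∀ {i} → Reach G i i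
  step : ∀ {i k j} → adj G i k ≡ true → Reach G k j → Reach G i j

Connected : ∀ {n} → Graph n → Set
Connected G = ∀ i j → Reach G i j

isEdge : ∀ {n} → Graph n → Fin n → Fin n → Bool
isEdge G i j = if ⌊ i <? j ⌋ then adj G i j else false

numEdges : ∀ {n} → Graph n → ℕ
numEdges G = sumℕ (λ i → sumℕ (λ j → if isEdge G i j then 1 else 0))

degree : ∀ {n} → Graph n → Fin n → ℕ
degree G i = sumℕ (λ j → if adj G i j then 1 else 0)

maxDegree : ∀ {n} → Graph n → ℕ
maxDegree G = maxℕ (degree G)

sumEdges : ∀ {n} → Graph n → (Fin n → Fin n → ℚ) → ℚ
sumEdges G f = sumℚ (λ i → sumℚ (λ j → if isEdge G i j then f i j else 0ℚ))

laplacian : ∀ {n} → Graph n → (Fin n → ℚ) → Fin n → ℚ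
laplacian G v k = sumℚ (λ l → if adj G k l then v k - v l else 0ℚ)

δ : ∀ {n} → Fin n → Fin n → ℚ
δ i k = if ⌊ i ≟ k ⌋ then 1ℚ else 0ℚ

-- Ω is the effective resistance function of G (unit resistors): for each i, j,
-- injecting unit current at i and extracting it at j, there is a potential v
-- satisfying Kirchhoff's laws (L v = e_i - e_j), and Ω i j = v i - v j.
IsEffectiveResistance : ∀ {n} → Graph n → (Fin n → Fin n → ℚ) → Set
IsEffectiveResistance {n} G Ω =
  ∀ i j → Σ (Fin n → ℚ) λ v →
    (∀ k → laplacian G v k ≡ δ i k - δ j k) × (Ω i j ≡ v i - v j)

-- Global cyclicity index, given Ω and the reciprocals r i j = 1 / Ω i j on edges:
-- C(G) = Σ_{ij ∈ E} (1/Ω(i,j) - 1)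
cyclicity : ∀ {n} → Graph n → (Fin n → Fin n → ℚ) → ℚ
cyclicity G r = sumEdges G (λ i j → r i j - 1ℚ)

bound : ∀ {n} → Graph n → ℚ
bound G = (+ numEdges G) / 1 * ((+ maxDegree G) / 1 - 1ℚ) * ((+ 1) / 2)

-- Fix an edge ij, let v be the potential of the unit current from i to j (so L v = e_i - e_j
-- and Ω(i,j) = v_i - v_j) and put w = (e_i - e_j) - 2 v / Ω(i,j). Expanding the nonnegative
-- Dirichlet energy of w with Green's identity gives 4 / Ω(i,j) ≤ d_i + d_j + 2 ≤ 2Δ + 2,
-- so every edge contributes at most (Δ - 1)/2 to C(G); summing over the m edges gives the bound.
module Submission where

open import Defs
open import Data.Nat using (ℕ)
open import Data.Fin using (Fin)
open import Data.Bool using (true)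
open import Data.Rational using (ℚ; 1ℚ; _*_; _≤_)
open import Relation.Binary.PropositionalEquality using (_≡_)

open import Algebra.Bundles using (CommutativeRing)
open import Data.Bool using (Bool; false; if_then_else_)
open import Data.Empty using (⊥-elim)
open import Data.Fin using (zero; suc; _<?_)
open import Data.Fin.Properties using (_≟_)
open import Data.Integer using (+_) renaming (_+_ to _+ℤ_)
import Data.Integer.Properties as ℤ
import Data.Nat as ℕ
import Data.Nat.Properties as ℕ
open import Data.Product using (_,_)
open import Data.Rational using (0ℚ; _+_; _-_; -_; _/_; NonNegative; nonNegative; nonPositive)
import Data.Rational.Properties as ℚ
open import Data.Rational.Solver using (module +-*-Solver)
import Data.Rational.Unnormalised as ℚᵘ
import Data.Rational.Unnormalised.Properties as ℚᵘ
open import Data.Sum using (inj₁; inj₂)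
open import Relation.Binary.PropositionalEquality using (_≢_; refl; trans; cong; cong₂; subst)
import Relation.Binary.PropositionalEquality as ≡
open import Relation.Nullary using (yes; no)
open import Relation.Nullary.Decidable using (⌊_⌋)

open import Algebra.Properties.Semiring.Sum (CommutativeRing.semiring ℚ.+-*-commutativeRing) using (sum; sum-cong-≗; sum-replicate-zero; ∑-distrib-+; ∑-comm; *-distribˡ-sum)
open +-*-Solver

private
  variable
    m n : ℕ

½ ¼ ⅛ : ℚ
½ = + 1 / 2
¼ = + 1 / 4
⅛ = + 1 / 8

*-self-nonNeg : ∀ x → 0ℚ ≤ x * x
*-self-nonNeg x with ℚ.≤-total 0ℚ x
... | inj₁ 0≤x = subst (_≤ x * x) (ℚ.*-zeroʳ x) (ℚ.*-monoˡ-≤-nonNeg x {{nonNegative 0≤x}} 0≤x)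
... | inj₂ x≤0 = subst (_≤ x * x) (ℚ.*-zeroʳ x) (ℚ.*-monoˡ-≤-nonPos x {{nonPositive x≤0}} x≤0)

*-nonNeg : ∀ c {x} → .{{NonNegative c}} → 0ℚ ≤ x → 0ℚ ≤ c * x
*-nonNeg c {x} 0≤x = subst (_≤ c * x) (ℚ.*-zeroʳ c) (ℚ.*-monoˡ-≤-nonNeg c 0≤x)

sumℚ≡sum : (f : Fin n → ℚ) → sumℚ f ≡ sum f
sumℚ≡sum {ℕ.zero}  f = refl
sumℚ≡sum {ℕ.suc n} f = cong (_+_ (f zero)) (sumℚ≡sum (λ k → f (suc k)))

sumℚ-cong : {f g : Fin n → ℚ} → (∀ k → f k ≡ g k) → sumℚ f ≡ sumℚ g
sumℚ-cong {f = f} {g} f≗g = trans (sumℚ≡sum f) (trans (sum-cong-≗ f≗g) (≡.sym (sumℚ≡sum g)))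

sumℚ-distrib-+ : (f g : Fin n → ℚ) → sumℚ (λ k → f k + g k) ≡ sumℚ f + sumℚ g
sumℚ-distrib-+ f g = trans (sumℚ≡sum (λ k → f k + g k))
  (trans (∑-distrib-+ f g) (≡.sym (cong₂ _+_ (sumℚ≡sum f) (sumℚ≡sum g))))

*-distribˡ-sumℚ : (c : ℚ) (f : Fin n → ℚ) → sumℚ (λ k → c * f k) ≡ c * sumℚ f
*-distribˡ-sumℚ c f = trans (sumℚ≡sum (λ k → c * f k))
  (trans (≡.sym (*-distribˡ-sum c f)) (cong (c *_) (≡.sym (sumℚ≡sum f))))

neg-distrib-sumℚ : (f : Fin n → ℚ) → sumℚ (λ k → - f k) ≡ - sumℚ f
neg-distrib-sumℚ {ℕ.zero}  f = refl
neg-distrib-sumℚ {ℕ.suc n} f = trans (cong (_+_ (- f zero)) (neg-distrib-sumℚ (λ k → f (suc k))))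
  (≡.sym (ℚ.neg-distrib-+ (f zero) _))

sumℚ-comm : (f : Fin m → Fin n → ℚ) →
  sumℚ (λ k → sumℚ (f k)) ≡ sumℚ (λ l → sumℚ (λ k → f k l))
sumℚ-comm f = trans (sumℚ²≡sum² f) (trans (∑-comm f) (≡.sym (sumℚ²≡sum² (λ l k → f k l))))
  where
  sumℚ²≡sum² : (g : Fin m → Fin n → ℚ) → sumℚ (λ k → sumℚ (g k)) ≡ sum (λ k → sum (g k))
  sumℚ²≡sum² g = trans (sumℚ≡sum (λ k → sumℚ (g k))) (sum-cong-≗ (λ k → sumℚ≡sum (g k)))

sumℚ-mono-≤ : (f g : Fin n → ℚ) → (∀ k → f k ≤ g k) → sumℚ f ≤ sumℚ g
sumℚ-mono-≤ {ℕ.zero}  f g f≤g = ℚ.≤-refl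
sumℚ-mono-≤ {ℕ.suc n} f g f≤g =
  ℚ.+-mono-≤ (f≤g zero) (sumℚ-mono-≤ (λ k → f (suc k)) (λ k → g (suc k)) (λ k → f≤g (suc k)))

sumℚ-nonNeg : (f : Fin n → ℚ) → (∀ k → 0ℚ ≤ f k) → 0ℚ ≤ sumℚ f
sumℚ-nonNeg {ℕ.zero}  f 0≤f = ℚ.≤-refl
sumℚ-nonNeg {ℕ.suc n} f 0≤f =
  ℚ.+-mono-≤ (0≤f zero) (sumℚ-nonNeg (λ k → f (suc k)) (λ k → 0≤f (suc k)))

δ-suc : (i k : Fin n) → δ (suc i) (suc k) ≡ δ i k
δ-suc i k with i ≟ k
... | yes _ = refl
... | no  _ = refl

δ-refl : (i : Fin n) → δ i i ≡ 1ℚ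
δ-refl i with i ≟ i
... | yes _   = refl
... | no  i≢i = ⊥-elim (i≢i refl)

δ-≢ : {i j : Fin n} → i ≢ j → δ i j ≡ 0ℚ
δ-≢ {i = i} {j} i≢j with i ≟ j
... | yes i≡j = ⊥-elim (i≢j i≡j)
... | no  _   = refl

sumℚ-*-δ : (f : Fin n → ℚ) (i : Fin n) → sumℚ (λ k → f k * δ i k) ≡ f i
sumℚ-*-δ {ℕ.suc n} f zero = trans
  (cong₂ _+_ (ℚ.*-identityʳ (f zero)) (sumℚ-cong (λ k → ℚ.*-zeroʳ (f (suc k)))))
  (trans (cong (_+_ (f zero)) (trans (sumℚ≡sum {n} (λ _ → 0ℚ)) (sum-replicate-zero n))) (ℚ.+-identityʳ (f zero)))
sumℚ-*-δ {ℕ.suc n} f (suc i) = trans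
  (cong₂ _+_ (ℚ.*-zeroʳ (f zero))
    (trans (sumℚ-cong (λ k → cong (f (suc k) *_) (δ-suc i k))) (sumℚ-*-δ (λ k → f (suc k)) i)))
  (ℚ.+-identityˡ (f (suc i)))

dipole : Fin n → Fin n → Fin n → ℚ
dipole i j k = δ i k - δ j k

dot : (Fin n → ℚ) → (Fin n → ℚ) → ℚ
dot f g = sumℚ (λ k → f k * g k)

dot-comm : (f g : Fin n → ℚ) → dot f g ≡ dot g f
dot-comm f g = sumℚ-cong (λ k → ℚ.*-comm (f k) (g k))

dot-dipole : (f : Fin n → ℚ) (i j : Fin n) → dot f (dipole i j) ≡ f i - f j
dot-dipole f i j = trans (sumℚ-cong (λ k → *-distribˡ-sub (f k) (δ i k) (δ j k)))
  (trans (sumℚ-distrib-+ (λ k → f k * δ i k) (λ k → - (f k * δ j k)))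
    (cong₂ _+_ (sumℚ-*-δ f i) (trans (neg-distrib-sumℚ (λ k → f k * δ j k)) (cong -_ (sumℚ-*-δ f j)))))
  where
  *-distribˡ-sub : ∀ x a b → x * (a - b) ≡ x * a + - (x * b)
  *-distribˡ-sub = solve 3 (λ x a b → x :* (a :- b) := x :* a :+ (:- (x :* b))) refl

dipole-source : {i j : Fin n} → i ≢ j → dipole i j i ≡ 1ℚ
dipole-source {i = i} i≢j = cong₂ _-_ (δ-refl i) (δ-≢ (λ j≡i → i≢j (≡.sym j≡i)))

dipole-sink : {i j : Fin n} → i ≢ j → dipole i j j ≡ - 1ℚ
dipole-sink {j = j} i≢j = cong₂ _-_ (δ-≢ i≢j) (δ-refl j)

ι : ℕ → ℚ
ι a = + a / 1

ι-homo-+ : ∀ a b → ι a + ι b ≡ ι (a ℕ.+ b)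
ι-homo-+ a b = ℚ.toℚᵘ-injective (ℚᵘ.≃-trans (ℚ.toℚᵘ-homo-+ (ι a) (ι b))
  (ℚᵘ.≃-trans (ℚᵘ.+-cong (ℚ.toℚᵘ-fromℚᵘ [ a ]) (ℚ.toℚᵘ-fromℚᵘ [ b ]))
    (ℚᵘ.≃-trans [a]+[b]≃[a+b] (ℚᵘ.≃-sym (ℚ.toℚᵘ-fromℚᵘ [ a ℕ.+ b ])))))
  where
  [_] : ℕ → ℚᵘ.ℚᵘ
  [ c ] = ℚᵘ.mkℚᵘ (+ c) 0
  [a]+[b]≃[a+b] : [ a ] ℚᵘ.+ [ b ] ℚᵘ.≃ [ a ℕ.+ b ]
  [a]+[b]≃[a+b] = ℚᵘ.*≡* (trans (ℤ.*-identityʳ _)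
    (trans (cong₂ _+ℤ_ (ℤ.*-identityʳ (+ a)) (ℤ.*-identityʳ (+ b)))
      (trans (≡.sym (ℤ.pos-+ a b)) (≡.sym (ℤ.*-identityʳ _)))))

ι-nonNeg : ∀ a → 0ℚ ≤ ι a
ι-nonNeg a = ℚ.nonNegative⁻¹ (ι a) {{ℚ.normalize-nonNeg a 1}}

ι-mono-≤ : ∀ {a b} → a ℕ.≤ b → ι a ≤ ι b
ι-mono-≤ {a} {b} a≤b = subst (ι a ≤_) (trans (ι-homo-+ a (b ℕ.∸ a)) (cong ι (ℕ.m+[n∸m]≡n a≤b)))
  (subst (_≤ ι a + ι (b ℕ.∸ a)) (ℚ.+-identityʳ (ι a)) (ℚ.+-monoʳ-≤ (ι a) (ι-nonNeg (b ℕ.∸ a))))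

ι-sumℕ : (f : Fin n → ℕ) → sumℚ (λ k → ι (f k)) ≡ ι (sumℕ f)
ι-sumℕ {ℕ.zero}  f = refl
ι-sumℕ {ℕ.suc n} f = trans (cong (_+_ (ι (f zero))) (ι-sumℕ (λ k → f (suc k)))) (ι-homo-+ (f zero) _)

f≤maxℕ : (f : Fin n → ℕ) (k : Fin n) → f k ℕ.≤ maxℕ f
f≤maxℕ f zero    = ℕ.m≤m⊔n (f zero) _
f≤maxℕ f (suc k) = ℕ.≤-trans (f≤maxℕ (λ k → f (suc k)) k) (ℕ.m≤n⊔m (f zero) _)

when : Bool → ℚ → ℚ
when b x = if b then x else 0ℚ

when-+ : ∀ b x y → when b (x + y) ≡ when b x + when b y
when-+ true  x y = refl
when-+ false x y = refl

when-* : ∀ b c x → when b (c * x) ≡ c * when b x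
when-* true  c x = refl
when-* false c x = ≡.sym (ℚ.*-zeroʳ c)

when≡*-when-1 : ∀ b x → when b x ≡ x * when b 1ℚ
when≡*-when-1 true  x = ≡.sym (ℚ.*-identityʳ x)
when≡*-when-1 false x = ≡.sym (ℚ.*-zeroʳ x)

when-1≡ι : ∀ b → when b 1ℚ ≡ ι (if b then 1 else 0)
when-1≡ι true  = refl
when-1≡ι false = refl

when-nonNeg : ∀ b {x} → 0ℚ ≤ x → 0ℚ ≤ when b x
when-nonNeg true  0≤x = 0≤x
when-nonNeg false 0≤x = ℚ.≤-refl

when-mono-≤ : ∀ b {x y} → (b ≡ true → x ≤ y) → when b x ≤ when b y
when-mono-≤ true  x≤y = x≤y refl
when-mono-≤ false x≤y = ℚ.≤-refl

module _ (G : Graph n) where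

  adj⇒≢ : {i j : Fin n} → adj G i j ≡ true → i ≢ j
  adj⇒≢ {i} i~j refl with trans (≡.sym (irrefl G i)) i~j
  ... | ()

  sumArcs : (Fin n → Fin n → ℚ) → ℚ
  sumArcs h = sumℚ (λ k → sumℚ (λ l → when (adj G k l) (h k l)))

  sumArcs-cong : {h h′ : Fin n → Fin n → ℚ} → (∀ k l → h k l ≡ h′ k l) → sumArcs h ≡ sumArcs h′
  sumArcs-cong h≗h′ = sumℚ-cong (λ k → sumℚ-cong (λ l → cong (when (adj G k l)) (h≗h′ k l)))

  sumArcs-+ : (h h′ : Fin n → Fin n → ℚ) → sumArcs (λ k l → h k l + h′ k l) ≡ sumArcs h + sumArcs h′
  sumArcs-+ h h′ = trans
    (sumℚ-cong (λ k → trans (sumℚ-cong (λ l → when-+ (adj G k l) (h k l) (h′ k l)))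
      (sumℚ-distrib-+ (λ l → when (adj G k l) (h k l)) (λ l → when (adj G k l) (h′ k l)))))
    (sumℚ-distrib-+ (λ k → sumℚ (λ l → when (adj G k l) (h k l)))
                    (λ k → sumℚ (λ l → when (adj G k l) (h′ k l))))

  sumArcs-* : (c : ℚ) (h : Fin n → Fin n → ℚ) → sumArcs (λ k l → c * h k l) ≡ c * sumArcs h
  sumArcs-* c h = trans
    (sumℚ-cong (λ k → trans (sumℚ-cong (λ l → when-* (adj G k l) c (h k l)))
      (*-distribˡ-sumℚ c (λ l → when (adj G k l) (h k l)))))
    (*-distribˡ-sumℚ c (λ k → sumℚ (λ l → when (adj G k l) (h k l))))

  sumArcs-nonNeg : (h : Fin n → Fin n → ℚ) → (∀ k l → 0ℚ ≤ h k l) → 0ℚ ≤ sumArcs h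
  sumArcs-nonNeg h 0≤h = sumℚ-nonNeg _ (λ k → sumℚ-nonNeg _ (λ l → when-nonNeg (adj G k l) (0≤h k l)))

  energy : (Fin n → ℚ) → (Fin n → ℚ) → ℚ
  energy f g = sumArcs (λ k l → (f k - f l) * (g k - g l))

  energy-nonNeg : (f : Fin n → ℚ) → 0ℚ ≤ energy f f
  energy-nonNeg f = sumArcs-nonNeg _ (λ k l → *-self-nonNeg (f k - f l))

  energy-expand : (f g : Fin n → ℚ) (t : ℚ) →
    energy (λ k → f k - t * g k) (λ k → f k - t * g k) ≡
    energy f f + (- (t + t)) * energy f g + (t * t) * energy g g
  energy-expand f g t = trans (sumArcs-cong (λ k l → square-expand (f k) (f l) (g k) (g l) t))
    (trans (sumArcs-+ (λ k l → ff k l + (- (t + t)) * fg k l) (λ k l → (t * t) * gg k l))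
      (cong₂ _+_ (trans (sumArcs-+ ff (λ k l → (- (t + t)) * fg k l)) (cong (_+_ (energy f f)) (sumArcs-* (- (t + t)) fg)))
                 (sumArcs-* (t * t) gg)))
    where
    ff fg gg : Fin n → Fin n → ℚ
    ff k l = (f k - f l) * (f k - f l)
    fg k l = (f k - f l) * (g k - g l)
    gg k l = (g k - g l) * (g k - g l)
    square-expand : ∀ a b c d t →
      ((a - t * c) - (b - t * d)) * ((a - t * c) - (b - t * d)) ≡
      (a - b) * (a - b) + (- (t + t)) * ((a - b) * (c - d)) + (t * t) * ((c - d) * (c - d))
    square-expand = solve 5 (λ a b c d t →
      ((a :- t :* c) :- (b :- t :* d)) :* ((a :- t :* c) :- (b :- t :* d)) :=
      (a :- b) :* (a :- b) :+ (:- (t :+ t)) :* ((a :- b) :* (c :- d)) :+ (t :* t) :* ((c :- d) :* (c :- d))) refl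

  -- Green's identity: each arc kl appears together with its reverse lk.
  energy≡dot-laplacian : (f g : Fin n → ℚ) → energy f g ≡ dot f (laplacian G g) + dot f (laplacian G g)
  energy≡dot-laplacian f g = trans (sumArcs-cong (λ k l → split (f k) (f l) (g k) (g l)))
    (trans (sumArcs-+ out into) (cong₂ _+_ out≡dot (trans into≡out out≡dot)))
    where
    split : ∀ a b c d → (a - b) * (c - d) ≡ a * (c - d) + b * (d - c)
    split = solve 4 (λ a b c d → (a :- b) :* (c :- d) := a :* (c :- d) :+ b :* (d :- c)) refl
    out into : Fin n → Fin n → ℚ
    out  k l = f k * (g k - g l)
    into k l = f l * (g l - g k)
    out≡dot : sumArcs out ≡ dot f (laplacian G g)
    out≡dot = sumℚ-cong (λ k → trans (sumℚ-cong (λ l → when-* (adj G k l) (f k) (g k - g l)))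
      (*-distribˡ-sumℚ (f k) (λ l → when (adj G k l) (g k - g l))))
    into≡out : sumArcs into ≡ sumArcs out
    into≡out = trans (sumℚ-comm (λ k l → when (adj G k l) (into k l)))
      (sumℚ-cong (λ l → sumℚ-cong (λ k → cong (λ b → when b (into k l)) (Graph.sym G k l))))

  adjacency : Fin n → Fin n → ℚ
  adjacency k l = when (adj G k l) 1ℚ

  degreeℚ : Fin n → ℚ
  degreeℚ k = sumℚ (adjacency k)

  degreeℚ≤maxDegree : (k : Fin n) → degreeℚ k ≤ ι (maxDegree G)
  degreeℚ≤maxDegree k = subst (_≤ ι (maxDegree G))
    (≡.sym (trans (sumℚ-cong (λ l → when-1≡ι (adj G k l))) (ι-sumℕ (λ l → if adj G k l then 1 else 0))))
    (ι-mono-≤ (f≤maxℕ (degree G) k))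

  laplacian-expand : (f : Fin n → ℚ) (k : Fin n) → laplacian G f k ≡ f k * degreeℚ k - dot (adjacency k) f
  laplacian-expand f k = trans (sumℚ-cong (λ l → split (adj G k l) (f k) (f l)))
    (trans (sumℚ-distrib-+ (λ l → f k * adjacency k l) (λ l → - (adjacency k l * f l)))
      (cong₂ _+_ (*-distribˡ-sumℚ (f k) (adjacency k)) (neg-distrib-sumℚ (λ l → adjacency k l * f l))))
    where
    split : ∀ b x y → when b (x - y) ≡ x * when b 1ℚ + - (when b 1ℚ * y)
    split true  = solve 2 (λ x y → x :- y := x :* con 1ℚ :+ (:- (con 1ℚ :* y))) refl
    split false = solve 2 (λ x y → con 0ℚ := x :* con 0ℚ :+ (:- (con 0ℚ :* y))) refl

  laplacian-dipole-source : {i j : Fin n} → adj G i j ≡ true → laplacian G (dipole i j) i ≡ degreeℚ i + 1ℚ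
  laplacian-dipole-source {i} {j} i~j = trans (laplacian-expand (dipole i j) i)
    (trans (cong₂ (λ x y → x * degreeℚ i - y) (dipole-source (adj⇒≢ i~j))
             (trans (dot-dipole (adjacency i) i j)
               (cong₂ (λ a b → when a 1ℚ - when b 1ℚ) (irrefl G i) i~j)))
      (solve 1 (λ d → con 1ℚ :* d :- (con 0ℚ :- con 1ℚ) := d :+ con 1ℚ) refl (degreeℚ i)))

  laplacian-dipole-sink : {i j : Fin n} → adj G i j ≡ true → laplacian G (dipole i j) j ≡ - (degreeℚ j + 1ℚ)
  laplacian-dipole-sink {i} {j} i~j = trans (laplacian-expand (dipole i j) j)
    (trans (cong₂ (λ x y → x * degreeℚ j - y) (dipole-sink (adj⇒≢ i~j))
             (trans (dot-dipole (adjacency j) i j)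
               (cong₂ (λ a b → when a 1ℚ - when b 1ℚ) (trans (Graph.sym G j i) i~j) (irrefl G j))))
      (solve 1 (λ d → (:- con 1ℚ) :* d :- (con 1ℚ :- con 0ℚ) := :- (d :+ con 1ℚ)) refl (degreeℚ j)))

  energy-dipole : {i j : Fin n} → adj G i j ≡ true →
    energy (dipole i j) (dipole i j) ≡ (degreeℚ i + degreeℚ j + 1ℚ + 1ℚ) + (degreeℚ i + degreeℚ j + 1ℚ + 1ℚ)
  energy-dipole {i} {j} i~j = trans (energy≡dot-laplacian (dipole i j) (dipole i j)) (cong₂ _+_ gap gap)
    where
    gap : dot (dipole i j) (laplacian G (dipole i j)) ≡ degreeℚ i + degreeℚ j + 1ℚ + 1ℚ
    gap = trans (dot-comm (dipole i j) (laplacian G (dipole i j)))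
      (trans (dot-dipole (laplacian G (dipole i j)) i j)
        (trans (cong₂ _-_ (laplacian-dipole-source i~j) (laplacian-dipole-sink i~j))
          (solve 2 (λ a b → (a :+ con 1ℚ) :- (:- (b :+ con 1ℚ)) := a :+ b :+ con 1ℚ :+ con 1ℚ) refl
            (degreeℚ i) (degreeℚ j))))

  energy-potential : {i j : Fin n} (f v : Fin n → ℚ) → (∀ k → laplacian G v k ≡ dipole i j k) →
    energy f v ≡ (f i - f j) + (f i - f j)
  energy-potential {i} {j} f v Lv≡dipole = trans (energy≡dot-laplacian f v) (cong₂ _+_ value value)
    where
    value : dot f (laplacian G v) ≡ f i - f j
    value = trans (sumℚ-cong (λ k → cong (f k *_) (Lv≡dipole k))) (dot-dipole f i j)

  -- t = 2 r minimises the energy of u - t v, and r Ω = 1 turns its r² Ω term into r.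
  reciprocal-resistance-≤ : {i j : Fin n} → adj G i j ≡ true →
    (v : Fin n → ℚ) → (∀ k → laplacian G v k ≡ dipole i j k) →
    (r : ℚ) → r * (v i - v j) ≡ 1ℚ →
    r ≤ (degreeℚ i + degreeℚ j + 1ℚ + 1ℚ) * ¼
  reciprocal-resistance-≤ {i} {j} i~j v Lv≡dipole r r*Ω≡1 = begin
    r                                          ≡⟨ ≡.sym (ℚ.+-identityʳ r) ⟩
    r + 0ℚ                                     ≤⟨ ℚ.+-monoʳ-≤ r (*-nonNeg ⅛ (energy-nonNeg w)) ⟩
    r + ⅛ * energy w w                         ≡⟨ cong (λ e → r + ⅛ * e) energy-w ⟩
    r + ⅛ * ((X + X) + - (t + t) * (U + U) + (t * t) * (Ω + Ω))
                                               ≡⟨ collect X (v i) (v j) r ⟩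
    X * ¼ + r * (r * Ω - 1ℚ)                   ≡⟨ cong (λ x → X * ¼ + r * (x - 1ℚ)) r*Ω≡1 ⟩
    X * ¼ + r * (1ℚ - 1ℚ)                      ≡⟨ solve 2 (λ x r → x :+ r :* (con 1ℚ :- con 1ℚ) := x) refl (X * ¼) r ⟩
    X * ¼                                      ∎
    where
    open ℚ.≤-Reasoning
    u : Fin n → ℚ
    u = dipole i j
    X U Ω t : ℚ
    X = degreeℚ i + degreeℚ j + 1ℚ + 1ℚ
    U = 1ℚ - - 1ℚ
    Ω = v i - v j
    t = r + r
    w : Fin n → ℚ
    w k = u k - t * v k
    energy-w : energy w w ≡ (X + X) + - (t + t) * (U + U) + (t * t) * (Ω + Ω)
    energy-w = trans (energy-expand u v t)
      (cong₂ (λ a c → a + (t * t) * c)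
        (cong₂ (λ a b → a + - (t + t) * b)
          (energy-dipole i~j)
          (trans (energy-potential u v Lv≡dipole)
            (cong₂ (λ a b → (a - b) + (a - b)) (dipole-source (adj⇒≢ i~j)) (dipole-sink (adj⇒≢ i~j)))))
        (energy-potential v v Lv≡dipole))
    collect : ∀ x a b r →
      r + ⅛ * ((x + x) + - ((r + r) + (r + r)) * (U + U) + ((r + r) * (r + r)) * ((a - b) + (a - b))) ≡
      x * ¼ + r * (r * (a - b) - 1ℚ)
    collect = solve 4 (λ x a b r →
      r :+ con ⅛ :* ((x :+ x) :+ (:- ((r :+ r) :+ (r :+ r))) :* (con U :+ con U)
        :+ ((r :+ r) :* (r :+ r)) :* ((a :- b) :+ (a :- b))) :=
      x :* con ¼ :+ r :* (r :* (a :- b) :- con 1ℚ)) refl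

  cyclicity-term-≤ : {i j : Fin n} → adj G i j ≡ true →
    (v : Fin n → ℚ) → (∀ k → laplacian G v k ≡ dipole i j k) →
    (r : ℚ) → r * (v i - v j) ≡ 1ℚ →
    r - 1ℚ ≤ (ι (maxDegree G) - 1ℚ) * ½
  cyclicity-term-≤ {i} {j} i~j v Lv≡dipole r r*Ω≡1 = begin
    r - 1ℚ                                      ≤⟨ ℚ.+-monoˡ-≤ (- 1ℚ) (reciprocal-resistance-≤ i~j v Lv≡dipole r r*Ω≡1) ⟩
    (degreeℚ i + degreeℚ j + 1ℚ + 1ℚ) * ¼ - 1ℚ ≤⟨ ℚ.+-monoˡ-≤ (- 1ℚ) (ℚ.*-monoʳ-≤-nonNeg ¼ degrees≤) ⟩
    (Δ + Δ + 1ℚ + 1ℚ) * ¼ - 1ℚ                  ≡⟨ solve 1 (λ d → (d :+ d :+ con 1ℚ :+ con 1ℚ) :* con ¼ :- con 1ℚ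
                                                                := (d :- con 1ℚ) :* con ½) refl Δ ⟩
    (Δ - 1ℚ) * ½                                ∎
    where
    open ℚ.≤-Reasoning
    Δ : ℚ
    Δ = ι (maxDegree G)
    degrees≤ : degreeℚ i + degreeℚ j + 1ℚ + 1ℚ ≤ Δ + Δ + 1ℚ + 1ℚ
    degrees≤ = ℚ.+-monoˡ-≤ 1ℚ (ℚ.+-monoˡ-≤ 1ℚ (ℚ.+-mono-≤ (degreeℚ≤maxDegree i) (degreeℚ≤maxDegree j)))

  sumEdges-mono-≤ : (f g : Fin n → Fin n → ℚ) → (∀ i j → adj G i j ≡ true → f i j ≤ g i j) →
    sumEdges G f ≤ sumEdges G g
  sumEdges-mono-≤ f g f≤g = sumℚ-mono-≤ _ _ (λ i → sumℚ-mono-≤ _ _ (λ j →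
    when-mono-≤ (isEdge G i j) (λ e → f≤g i j (isEdge⇒adj ⌊ i <? j ⌋ e))))
    where
    isEdge⇒adj : ∀ {i j} b → (if b then adj G i j else false) ≡ true → adj G i j ≡ true
    isEdge⇒adj true  e = e
    isEdge⇒adj false ()

  sumEdges-const : (c : ℚ) → sumEdges G (λ _ _ → c) ≡ c * ι (numEdges G)
  sumEdges-const c = trans
    (sumℚ-cong (λ i → trans (sumℚ-cong (λ j → when≡*-when-1 (isEdge G i j) c))
      (*-distribˡ-sumℚ c (λ j → when (isEdge G i j) 1ℚ))))
    (trans (*-distribˡ-sumℚ c (λ i → sumℚ (λ j → when (isEdge G i j) 1ℚ)))
      (cong (c *_) (trans
        (sumℚ-cong (λ i → trans (sumℚ-cong (λ j → when-1≡ι (isEdge G i j)))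
          (ι-sumℕ (λ j → if isEdge G i j then 1 else 0))))
        (ι-sumℕ (λ i → sumℕ (λ j → if isEdge G i j then 1 else 0))))))

mainTheorem11 : (n : ℕ) (G : Graph n) → Connected G →
    (Ω : Fin n → Fin n → ℚ) → IsEffectiveResistance G Ω →
    (r : Fin n → Fin n → ℚ) → (∀ i j → adj G i j ≡ true → r i j * Ω i j ≡ 1ℚ) →
    cyclicity G r ≤ bound G
mainTheorem11 _ G _ _ isΩ r r*Ω≡1 = begin
  cyclicity G r                     ≤⟨ sumEdges-mono-≤ G _ _ term≤ ⟩
  sumEdges G (λ _ _ → (Δ - 1ℚ) * ½) ≡⟨ sumEdges-const G ((Δ - 1ℚ) * ½) ⟩
  (Δ - 1ℚ) * ½ * ι (numEdges G)     ≡⟨ solve 2 (λ d m → (d :- con 1ℚ) :* con ½ :* m := m :* (d :- con 1ℚ) :* con ½)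
                                               refl Δ (ι (numEdges G)) ⟩
  bound G                           ∎
  where
  open ℚ.≤-Reasoning
  Δ : ℚ
  Δ = ι (maxDegree G)
  term≤ : ∀ i j → adj G i j ≡ true → r i j - 1ℚ ≤ (Δ - 1ℚ) * ½
  term≤ i j i~j with isΩ i j
  ... | v , Lv≡dipole , Ω≡potential-drop =
    cyclicity-term-≤ G i~j v Lv≡dipole (r i j) (subst (λ x → r i j * x ≡ 1ℚ) Ω≡potential-drop (r*Ω≡1 i j i~j))
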